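{- Let $\alpha$ and $\beta$ be compositions. Then \[\Psi_\alpha \Psi_\beta = \frac{1}{C(\alpha,\beta)}\sum_{\gamma \in \alpha\,\text{⧢}\,\beta} \Psi_\gamma,\] where $\alpha\,\text{⧢}\,\beta$ denotes the multiset of shuffles of $\alpha$ and $\beta$.
   Context: Compositions $\alpha=(\alpha_1,\dots,\alpha_k)\vDash n$ are finite sequences of positive integers summing to $n$. For compositions $\alpha\preccurlyeq\beta$ (i.e. $\alpha$ refines $\beta$), $\alpha^{(i)}$ denotes the consecutive parts of $\alpha$ summing to $\beta_i$; $\pi(\gamma)=\prod_{i=1}^{\ell(\gamma)}\sum_{j=1}^i\gamma_j$ and $\pi(\alpha,\beta)=\prod_i\pi(\alpha^{(i)})$. For a composition $\alpha$, $z_\alpha=\prod_i i^{m_i}m_i!$, where $m_i$ is the number of parts of $\alpha$ equal to $i$. The type 1 quasisymmetric power sums are $\Psi_\alpha=z_\alpha\sum_{\beta\succcurlyeq\alpha}\frac{1}{\pi(\alpha,\beta)}M_\beta$, where $M_\beta$ are the monomial quasisymmetric functions; equivalently $\Psi_\alpha$ is the basis of QSym with $\langle \Psi_\alpha,\boldsymbol{\Psi}_\beta\rangle=z_\alpha\delta_{\alpha,\beta}$, $\boldsymbol{\Psi}$ being the noncommutative power sums of the first kind. The shuffle $[a_1,\dots,a_n]\,\text{⧢}\,[b_1,\dots,b_m]$ is the set of all length $m+n$ words obtained by interleaving the two sequences, preserving the relative order of the $a_i$ and of the $b_i$. If $a_j$ (resp. $b_j$) is the number of parts of size $j$ in $\alpha$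 (resp. $\beta$), then $C(\alpha,\beta)=\prod_j\binom{a_j+b_j}{a_j}=z_{\alpha\cdot\beta}/(z_\alpha z_\beta)$, where $\alpha\cdot\beta$ is the concatenation. -}

module Defs where

open import Data.Nat as ℕ using (ℕ; zero; suc; _≤_)
open import Data.Nat.Combinatorics using (_C_)
open import Data.Integer using (+_)
open import Data.Rational using (ℚ; 0ℚ; 1ℚ; _+_; _*_; _/_)
open import Data.List using (List; []; _∷_; map; _++_; concatMap; upTo)
open import Data.List.Relation.Unary.All using (All)
open import Relation.Nullary using (yes; no)
open import Data.Nat.Base using (_!)

IsComposition : List ℕ → Set
IsComposition α = All (λ p → 1 ≤ p) α

size : List ℕ → ℕ
size [] = 0
size (a ∷ as) = a ℕ.+ size as

prodℕ : List ℕ → ℕ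
prodℕ [] = 1
prodℕ (a ∷ as) = a ℕ.* prodℕ as

mult : ℕ → List ℕ → ℕ
mult i [] = 0
mult i (a ∷ as) with i ℕ.≟ a
... | yes _ = suc (mult i as)
... | no _ = mult i as

-- z_α = ∏_i i^{m_i} m_i!   (all parts are ≤ |α|, so i ranges over 1..|α|)
z : List ℕ → ℕ
z α = prodℕ (map (λ j → let i = suc j in (i ℕ.^ mult i α) ℕ.* (mult i α) ℕ.!) (upTo (size α)))

Cαβ : List ℕ → List ℕ → ℕ
Cαβ α β = prodℕ (map (λ j → let i = suc j in (mult i α ℕ.+ mult i β) C (mult i α))
                     (upTo (size α ℕ.+ size β)))

-- π(γ) = ∏_{i} (γ_1 + ... + γ_i)
piAux : ℕ → List ℕ → ℕ
piAux s [] = 1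
piAux s (g ∷ gs) = (s ℕ.+ g) ℕ.* piAux (s ℕ.+ g) gs

πc : List ℕ → ℕ
πc γ = piAux 0 γ

-- All ways to cut α into consecutive nonempty blocks α^(1),...,α^(k);
-- these correspond bijectively to the coarsenings β ≽ α (β_i = |α^(i)|).
blockings : List ℕ → List (List (List ℕ))
blockings [] = [] ∷ []
blockings (a ∷ as) = concatMap ext (blockings as)
  where
  ext : List (List ℕ) → List (List (List ℕ))
  ext [] = ((a ∷ []) ∷ []) ∷ []
  ext (b ∷ bs) = ((a ∷ []) ∷ b ∷ bs) ∷ ((a ∷ b) ∷ bs) ∷ []

πblocks : List (List ℕ) → ℕ
πblocks bs = prodℕ (map πc bs)

-- rational 1/n (n = 0 sent to 0; never used on compositions)
inv : ℕ → ℚ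
inv zero = 0ℚ
inv (suc n) = + 1 / suc n

fromℕ : ℕ → ℚ
fromℕ n = + n / 1

_^q_ : ℚ → ℕ → ℚ
x ^q zero = 1ℚ
x ^q suc n = x * (x ^q n)

sumℚ : List ℚ → ℚ
sumℚ [] = 0ℚ
sumℚ (q ∷ qs) = q + sumℚ qs

-- Monomial quasisymmetric function M_β evaluated at the variables x_1,...,x_N
-- (given as a list): sum over i_1 < ... < i_k of x_{i_1}^{β_1} ... x_{i_k}^{β_k}.
M : List ℕ → List ℚ → ℚ
M [] xs = 1ℚ
M (b ∷ bs) [] = 0ℚ
M (b ∷ bs) (x ∷ xs) = (x ^q b) * M bs xs + M (b ∷ bs) xs

-- Type 1 quasisymmetric power sum Ψ_α = z_α Σ_{β ≽ α} (1/π(α,β)) M_β, evaluated.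
Ψ : List ℕ → List ℚ → ℚ
Ψ α xs = fromℕ (z α) * sumℚ (map (λ bs → inv (πblocks bs) * M (map size bs) xs) (blockings α))

-- Shuffles of two sequences, as a list (= multiset, with multiplicity).
shuffle : List ℕ → List ℕ → List (List ℕ)
shuffle [] ys = ys ∷ []
shuffle (x ∷ xs) [] = (x ∷ xs) ∷ []
shuffle (x ∷ xs) (y ∷ ys) = map (x ∷_) (shuffle xs (y ∷ ys)) ++ map (y ∷_) (shuffle (x ∷ xs) ys)

-- Write Ψ α = z α · ψ α.  The normalised power sums satisfy the plain shuffle rule
-- ψ α · ψ β = ∑_{γ ∈ α ⧢ β} ψ γ, by induction on the number of variables: splitting off the
-- first variable x writes ψ α (x ∷ xs) as a sum over deconcatenations α = p · s of
-- x^|p| / π(p) · ψ s xs.  Deconcatenation commutes with shuffling, and on compositions 1/π is a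
-- shuffle character, ∑_{r ∈ p ⧢ q} 1/π(r) = 1/π(p) · 1/π(q): peel off the last part of r and use
-- 1/(A+B) · (1/A + 1/B) = 1/(AB).  Finally every shuffle γ of α and β has the parts of α and β
-- together, so z γ = z α · z β · C(α,β).
{-# OPTIONS --safe #-}
module Submission where

open import Defs
open import Data.Nat as ℕ using (ℕ; zero; suc; NonZero; _!)
import Data.Nat.Properties as ℕ
open import Data.Nat.Combinatorics using (_C_; nCk≡n!/k![n-k]!; k![n∸k]!∣n!)
open import Data.Nat.DivMod using (m/n*n≡m)
open import Data.Nat.Tactic.RingSolver using (solve-∀)
import Data.Integer as ℤ
import Data.Integer.Properties as ℤ
import Data.Nat.Coprimality as Coprime
open import Data.Rational using (ℚ; mkℚ; 0ℚ; 1ℚ; _+_; _*_; toℚᵘ)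
open import Data.Rational.Properties
  using (↥p/↧p≡p; toℚᵘ-injective; toℚᵘ-homo-+; toℚᵘ-homo-*; +-identityˡ; +-identityʳ; +-assoc; +-comm;
         *-identityˡ; *-identityʳ; *-zeroˡ; *-zeroʳ; *-assoc; *-comm; *-distribˡ-+;
         +-0-commutativeMonoid; *-1-commutativeMonoid)
import Data.Rational.Unnormalised as ℚᵘ
import Data.Rational.Unnormalised.Properties as ℚᵘ
open import Data.Rational.Solver using (module +-*-Solver)
open import Algebra.Bundles using (CommutativeMonoid)
open import Algebra.Properties.CommutativeSemigroup (CommutativeMonoid.commutativeSemigroup +-0-commutativeMonoid)
  using () renaming (interchange to +-interchange)
open import Algebra.Properties.CommutativeSemigroup (CommutativeMonoid.commutativeSemigroup *-1-commutativeMonoid)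
  using () renaming (interchange to *-interchange)
open import Data.Product using (_×_; _,_; proj₁; proj₂; uncurry; map₁)
open import Data.List using (List; []; _∷_; map; _++_; concatMap; _∷ʳ_; upTo)
open import Data.List.Properties using (upTo-∷ʳ; map-++)
open import Data.List.Reverse using (Reverse; []; _∶_∶ʳ_; reverseView)
open import Data.List.Relation.Unary.All as All using (All; []; _∷_)
import Data.List.Relation.Unary.All.Properties as All
open import Function using (_∘_)
open import Data.Empty using (⊥-elim)
open import Relation.Nullary using (yes; no)
open import Relation.Binary.PropositionalEquality

toℚᵘ-fromℕ : ∀ n → toℚᵘ (fromℕ n) ≡ ℚᵘ.mkℚᵘ (ℤ.+ n) 0
toℚᵘ-fromℕ n = cong toℚᵘ (↥p/↧p≡p (mkℚ (ℤ.+ n) 0 (Coprime.sym (Coprime.1-coprimeTo n))))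

toℚᵘ-inv : ∀ n → toℚᵘ (inv (suc n)) ≡ ℚᵘ.mkℚᵘ (ℤ.+ 1) n
toℚᵘ-inv n = cong toℚᵘ (↥p/↧p≡p (mkℚ (ℤ.+ 1) n (Coprime.1-coprimeTo (suc n))))

fromℕ-+ : ∀ m n → fromℕ (m ℕ.+ n) ≡ fromℕ m + fromℕ n
fromℕ-+ m n = toℚᵘ-injective (begin
  toℚᵘ (fromℕ (m ℕ.+ n))
    ≡⟨ toℚᵘ-fromℕ (m ℕ.+ n) ⟩
  ℚᵘ.mkℚᵘ (ℤ.+ (m ℕ.+ n)) 0
    ≈⟨ ℚᵘ.*≡* (cong (ℤ._* ℤ.+ 1) numerators) ⟩
  ℚᵘ.mkℚᵘ (ℤ.+ m) 0 ℚᵘ.+ ℚᵘ.mkℚᵘ (ℤ.+ n) 0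
    ≡⟨ cong₂ ℚᵘ._+_ (toℚᵘ-fromℕ m) (toℚᵘ-fromℕ n) ⟨
  toℚᵘ (fromℕ m) ℚᵘ.+ toℚᵘ (fromℕ n)
    ≈⟨ ℚᵘ.≃-sym (toℚᵘ-homo-+ (fromℕ m) (fromℕ n)) ⟩
  toℚᵘ (fromℕ m + fromℕ n) ∎)
  where
  open ℚᵘ.≃-Reasoning
  numerators : ℤ.+ (m ℕ.+ n) ≡ ℤ.+ m ℤ.* ℤ.+ 1 ℤ.+ ℤ.+ n ℤ.* ℤ.+ 1
  numerators = trans (ℤ.pos-+ m n) (sym (cong₂ ℤ._+_ (ℤ.*-identityʳ (ℤ.+ m)) (ℤ.*-identityʳ (ℤ.+ n))))

fromℕ-* : ∀ m n → fromℕ (m ℕ.* n) ≡ fromℕ m * fromℕ n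
fromℕ-* m n = toℚᵘ-injective (begin
  toℚᵘ (fromℕ (m ℕ.* n))
    ≡⟨ toℚᵘ-fromℕ (m ℕ.* n) ⟩
  ℚᵘ.mkℚᵘ (ℤ.+ (m ℕ.* n)) 0
    ≈⟨ ℚᵘ.*≡* (cong (ℤ._* ℤ.+ 1) (ℤ.pos-* m n)) ⟩
  ℚᵘ.mkℚᵘ (ℤ.+ m) 0 ℚᵘ.* ℚᵘ.mkℚᵘ (ℤ.+ n) 0
    ≡⟨ cong₂ ℚᵘ._*_ (toℚᵘ-fromℕ m) (toℚᵘ-fromℕ n) ⟨
  toℚᵘ (fromℕ m) ℚᵘ.* toℚᵘ (fromℕ n)
    ≈⟨ ℚᵘ.≃-sym (toℚᵘ-homo-* (fromℕ m) (fromℕ n)) ⟩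
  toℚᵘ (fromℕ m * fromℕ n) ∎)
  where open ℚᵘ.≃-Reasoning

inv*fromℕ : ∀ n .{{_ : NonZero n}} → inv n * fromℕ n ≡ 1ℚ
inv*fromℕ (suc n) = toℚᵘ-injective (begin
  toℚᵘ (inv (suc n) * fromℕ (suc n))
    ≈⟨ toℚᵘ-homo-* (inv (suc n)) (fromℕ (suc n)) ⟩
  toℚᵘ (inv (suc n)) ℚᵘ.* toℚᵘ (fromℕ (suc n))
    ≡⟨ cong₂ ℚᵘ._*_ (toℚᵘ-inv n) (toℚᵘ-fromℕ (suc n)) ⟩
  ℚᵘ.mkℚᵘ (ℤ.+ 1) n ℚᵘ.* ℚᵘ.mkℚᵘ (ℤ.+ suc n) 0
    ≈⟨ ℚᵘ.*≡* cross-multiplied ⟩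
  ℚᵘ.1ℚᵘ ∎)
  where
  open ℚᵘ.≃-Reasoning
  cross-multiplied : (ℤ.+ 1 ℤ.* ℤ.+ suc n) ℤ.* ℤ.+ 1 ≡ ℤ.+ 1 ℤ.* (ℤ.+ suc n ℤ.* ℤ.+ 1)
  cross-multiplied = trans (ℤ.*-identityʳ (ℤ.+ 1 ℤ.* ℤ.+ suc n)) (cong (ℤ.+ 1 ℤ.*_) (sym (ℤ.*-identityʳ (ℤ.+ suc n))))

open ≡-Reasoning

inv-cancel : ∀ n .{{_ : NonZero n}} q → inv n * (fromℕ n * q) ≡ q
inv-cancel n q = begin
  inv n * (fromℕ n * q)   ≡⟨ *-assoc (inv n) (fromℕ n) q ⟨
  (inv n * fromℕ n) * q   ≡⟨ cong (_* q) (inv*fromℕ n) ⟩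
  1ℚ * q                  ≡⟨ *-identityˡ q ⟩
  q                       ∎

inv-unique : ∀ n .{{_ : NonZero n}} q → q * fromℕ n ≡ 1ℚ → q ≡ inv n
inv-unique n q q*n≡1 = begin
  q                       ≡⟨ inv-cancel n q ⟨
  inv n * (fromℕ n * q)   ≡⟨ cong (inv n *_) (trans (*-comm (fromℕ n) q) q*n≡1) ⟩
  inv n * 1ℚ              ≡⟨ *-identityʳ (inv n) ⟩
  inv n                   ∎

inv-* : ∀ m n → inv (m ℕ.* n) ≡ inv m * inv n
inv-* zero    n       = sym (*-zeroˡ (inv n))
inv-* (suc m) zero    = trans (cong inv (ℕ.*-zeroʳ m)) (sym (*-zeroʳ (inv (suc m))))
inv-* (suc m) (suc n) = sym (inv-unique (suc m ℕ.* suc n) (inv (suc m) * inv (suc n)) (begin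
  (inv (suc m) * inv (suc n)) * fromℕ (suc m ℕ.* suc n)
    ≡⟨ cong (inv (suc m) * inv (suc n) *_) (fromℕ-* (suc m) (suc n)) ⟩
  (inv (suc m) * inv (suc n)) * (fromℕ (suc m) * fromℕ (suc n))
    ≡⟨ *-interchange (inv (suc m)) (inv (suc n)) (fromℕ (suc m)) (fromℕ (suc n)) ⟩
  (inv (suc m) * fromℕ (suc m)) * (inv (suc n) * fromℕ (suc n))
    ≡⟨ cong₂ _*_ (inv*fromℕ (suc m)) (inv*fromℕ (suc n)) ⟩
  1ℚ ∎))

inv-+ : ∀ m n .{{_ : NonZero m}} .{{_ : NonZero n}} → inv (m ℕ.+ n) * (inv m + inv n) ≡ inv m * inv n
inv-+ m@(suc _) n = begin
  inv (m ℕ.+ n) * (inv m + inv n)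
    ≡⟨ cong (inv (m ℕ.+ n) *_) sum-of-inverses ⟩
  inv (m ℕ.+ n) * (fromℕ (m ℕ.+ n) * (inv m * inv n))
    ≡⟨ inv-cancel (m ℕ.+ n) (inv m * inv n) ⟩
  inv m * inv n ∎
  where
  open +-*-Solver
  sum-of-inverses : inv m + inv n ≡ fromℕ (m ℕ.+ n) * (inv m * inv n)
  sum-of-inverses = begin
    inv m + inv n
      ≡⟨ cong₂ _+_ (*-identityʳ (inv m)) (*-identityʳ (inv n)) ⟨
    inv m * 1ℚ + inv n * 1ℚ
      ≡⟨ cong₂ (λ u v → inv m * u + inv n * v) (inv*fromℕ n) (inv*fromℕ m) ⟨
    inv m * (inv n * fromℕ n) + inv n * (inv m * fromℕ m)
      ≡⟨ solve 4 (λ a b c d → a :* (b :* d) :+ b :* (a :* c) := (c :+ d) :* (a :* b))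
               refl (inv m) (inv n) (fromℕ m) (fromℕ n) ⟩
    (fromℕ m + fromℕ n) * (inv m * inv n)
      ≡⟨ cong (_* (inv m * inv n)) (fromℕ-+ m n) ⟨
    fromℕ (m ℕ.+ n) * (inv m * inv n) ∎

fromℕ*≡inv*fromℕ* : ∀ m n .{{_ : NonZero n}} q → fromℕ m * q ≡ inv n * (fromℕ (m ℕ.* n) * q)
fromℕ*≡inv*fromℕ* m n q = begin
  fromℕ m * q                            ≡⟨ inv-cancel n (fromℕ m * q) ⟨
  inv n * (fromℕ n * (fromℕ m * q))      ≡⟨ cong (inv n *_) (*-assoc (fromℕ n) (fromℕ m) q) ⟨
  inv n * ((fromℕ n * fromℕ m) * q)      ≡⟨ cong (λ k → inv n * (k * q)) (*-comm (fromℕ n) (fromℕ m)) ⟩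
  inv n * ((fromℕ m * fromℕ n) * q)      ≡⟨ cong (λ k → inv n * (k * q)) (fromℕ-* m n) ⟨
  inv n * (fromℕ (m ℕ.* n) * q)          ∎

nonZero-+ʳ : ∀ m n .{{_ : NonZero n}} → NonZero (m ℕ.+ n)
nonZero-+ʳ m n = ℕ.>-nonZero (ℕ.<-≤-trans (ℕ.>-nonZero⁻¹ n) (ℕ.m≤n+m n m))

^q-+ : ∀ x m n → x ^q (m ℕ.+ n) ≡ x ^q m * x ^q n
^q-+ x zero    n = sym (*-identityˡ (x ^q n))
^q-+ x (suc m) n = trans (cong (x *_) (^q-+ x m n)) (sym (*-assoc x (x ^q m) (x ^q n)))

∑ : {A : Set} → List A → (A → ℚ) → ℚ
∑ xs f = sumℚ (map f xs)

module _ {A : Set} where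

  ∑-cong : (xs : List A) {f g : A → ℚ} → (∀ x → f x ≡ g x) → ∑ xs f ≡ ∑ xs g
  ∑-cong []       f≗g = refl
  ∑-cong (x ∷ xs) f≗g = cong₂ _+_ (f≗g x) (∑-cong xs f≗g)

  ∑-cong-All : {xs : List A} {f g : A → ℚ} → All (λ x → f x ≡ g x) xs → ∑ xs f ≡ ∑ xs g
  ∑-cong-All []            = refl
  ∑-cong-All (fx≡gx ∷ eqs) = cong₂ _+_ fx≡gx (∑-cong-All eqs)

  ∑-zero : (xs : List A) {f : A → ℚ} → (∀ x → f x ≡ 0ℚ) → ∑ xs f ≡ 0ℚ
  ∑-zero []       f≗0 = refl
  ∑-zero (x ∷ xs) f≗0 = trans (cong₂ _+_ (f≗0 x) (∑-zero xs f≗0)) (+-identityʳ 0ℚ)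

  ∑-+ : (xs : List A) (f g : A → ℚ) → ∑ xs (λ x → f x + g x) ≡ ∑ xs f + ∑ xs g
  ∑-+ []       f g = refl
  ∑-+ (x ∷ xs) f g = trans (cong ((f x + g x) +_) (∑-+ xs f g)) (+-interchange (f x) (g x) (∑ xs f) (∑ xs g))

  *-distribˡ-∑ : (c : ℚ) (xs : List A) (f : A → ℚ) → c * ∑ xs f ≡ ∑ xs (λ x → c * f x)
  *-distribˡ-∑ c []       f = *-zeroʳ c
  *-distribˡ-∑ c (x ∷ xs) f = trans (*-distribˡ-+ c (f x) (∑ xs f)) (cong (c * f x +_) (*-distribˡ-∑ c xs f))

  *-distribʳ-∑ : (c : ℚ) (xs : List A) (f : A → ℚ) → ∑ xs f * c ≡ ∑ xs (λ x → f x * c)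
  *-distribʳ-∑ c xs f = trans (*-comm (∑ xs f) c) (trans (*-distribˡ-∑ c xs f) (∑-cong xs (λ x → *-comm c (f x))))

  ∑-++ : (xs ys : List A) (f : A → ℚ) → ∑ (xs ++ ys) f ≡ ∑ xs f + ∑ ys f
  ∑-++ []       ys f = sym (+-identityˡ (∑ ys f))
  ∑-++ (x ∷ xs) ys f = trans (cong (f x +_) (∑-++ xs ys f)) (sym (+-assoc (f x) (∑ xs f) (∑ ys f)))

  ∑-map : {B : Set} (g : B → A) (ys : List B) (f : A → ℚ) → ∑ (map g ys) f ≡ ∑ ys (f ∘ g)
  ∑-map g []       f = refl
  ∑-map g (y ∷ ys) f = cong (f (g y) +_) (∑-map g ys f)

  ∑-concatMap : {B : Set} (h : B → List A) (ys : List B) (f : A → ℚ) →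
    ∑ (concatMap h ys) f ≡ ∑ ys (λ y → ∑ (h y) f)
  ∑-concatMap h []       f = refl
  ∑-concatMap h (y ∷ ys) f = trans (∑-++ (h y) (concatMap h ys) f) (cong (∑ (h y) f +_) (∑-concatMap h ys f))

∑-*-∑ : {A B : Set} (xs : List A) (ys : List B) (f : A → ℚ) (g : B → ℚ) →
  ∑ xs f * ∑ ys g ≡ ∑ xs (λ x → ∑ ys (λ y → f x * g y))
∑-*-∑ xs ys f g = trans (*-distribʳ-∑ (∑ ys g) xs f) (∑-cong xs (λ x → *-distribˡ-∑ (f x) ys g))

shuffle-[]ʳ : ∀ p → shuffle p [] ≡ p ∷ []
shuffle-[]ʳ []      = refl
shuffle-[]ʳ (_ ∷ _) = refl

∑-shuffle-∷-∷ : ∀ a p b q (f : List ℕ → ℚ) →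
  ∑ (shuffle (a ∷ p) (b ∷ q)) f ≡ ∑ (shuffle p (b ∷ q)) (f ∘ (a ∷_)) + ∑ (shuffle (a ∷ p) q) (f ∘ (b ∷_))
∑-shuffle-∷-∷ a p b q f = trans (∑-++ (map (a ∷_) (shuffle p (b ∷ q))) (map (b ∷_) (shuffle (a ∷ p) q)) f)
  (cong₂ _+_ (∑-map (a ∷_) (shuffle p (b ∷ q)) f) (∑-map (b ∷_) (shuffle (a ∷ p) q) f))

∑-shuffle-∷ʳ-∷ʳ : ∀ p q x y (f : List ℕ → ℚ) →
  ∑ (shuffle (p ∷ʳ x) (q ∷ʳ y)) f ≡
  ∑ (shuffle p (q ∷ʳ y)) (f ∘ (_∷ʳ x)) + ∑ (shuffle (p ∷ʳ x) q) (f ∘ (_∷ʳ y))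
∑-shuffle-∷ʳ-∷ʳ []      []      x y f =
  trans (+-comm (f (x ∷ y ∷ [])) (f (y ∷ x ∷ []) + 0ℚ))
        (cong (f (y ∷ x ∷ []) + 0ℚ +_) (sym (+-identityʳ (f (x ∷ y ∷ [])))))
∑-shuffle-∷ʳ-∷ʳ []      (b ∷ q) x y f = begin
  ∑ (shuffle (x ∷ []) ((b ∷ q) ∷ʳ y)) f
    ≡⟨ ∑-shuffle-∷-∷ x [] b (q ∷ʳ y) f ⟩
  X + ∑ (shuffle (x ∷ []) (q ∷ʳ y)) (f ∘ (b ∷_))
    ≡⟨ cong (X +_) (∑-shuffle-∷ʳ-∷ʳ [] q x y (f ∘ (b ∷_))) ⟩
  X + (Q + R)
    ≡⟨ solve 3 (λ X Q R → X :+ (Q :+ R) := Q :+ (X :+ R)) refl X Q R ⟩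
  Q + (X + R)
    ≡⟨ cong (Q +_) (∑-shuffle-∷-∷ x [] b q (f ∘ (_∷ʳ y))) ⟨
  Q + ∑ (shuffle (x ∷ []) (b ∷ q)) (f ∘ (_∷ʳ y)) ∎
  where
  open +-*-Solver
  X = ∑ (shuffle [] ((b ∷ q) ∷ʳ y)) (f ∘ (x ∷_))
  Q = ∑ (shuffle [] (q ∷ʳ y)) (f ∘ (b ∷_) ∘ (_∷ʳ x))
  R = ∑ (shuffle (x ∷ []) q) (f ∘ (b ∷_) ∘ (_∷ʳ y))
∑-shuffle-∷ʳ-∷ʳ (a ∷ p) []      x y f = begin
  ∑ (shuffle ((a ∷ p) ∷ʳ x) (y ∷ [])) f
    ≡⟨ ∑-shuffle-∷-∷ a (p ∷ʳ x) y [] f ⟩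
  ∑ (shuffle (p ∷ʳ x) (y ∷ [])) (f ∘ (a ∷_)) + Y
    ≡⟨ cong (_+ Y) (∑-shuffle-∷ʳ-∷ʳ p [] x y (f ∘ (a ∷_))) ⟩
  (P + Q) + Y
    ≡⟨ solve 3 (λ P Q Y → (P :+ Q) :+ Y := (P :+ Y) :+ Q) refl P Q Y ⟩
  (P + Y) + Q
    ≡⟨ cong₂ _+_ (sym (∑-shuffle-∷-∷ a p y [] (f ∘ (_∷ʳ x))))
                 (cong (λ sh → ∑ sh (f ∘ (a ∷_) ∘ (_∷ʳ y))) (shuffle-[]ʳ (p ∷ʳ x))) ⟩
  ∑ (shuffle (a ∷ p) (y ∷ [])) (f ∘ (_∷ʳ x)) + ∑ (shuffle ((a ∷ p) ∷ʳ x) []) (f ∘ (_∷ʳ y)) ∎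
  where
  open +-*-Solver
  P = ∑ (shuffle p (y ∷ [])) (f ∘ (a ∷_) ∘ (_∷ʳ x))
  Q = ∑ (shuffle (p ∷ʳ x) []) (f ∘ (a ∷_) ∘ (_∷ʳ y))
  Y = ∑ (shuffle ((a ∷ p) ∷ʳ x) []) (f ∘ (y ∷_))
∑-shuffle-∷ʳ-∷ʳ (a ∷ p) (b ∷ q) x y f = begin
  ∑ (shuffle ((a ∷ p) ∷ʳ x) ((b ∷ q) ∷ʳ y)) f
    ≡⟨ ∑-shuffle-∷-∷ a (p ∷ʳ x) b (q ∷ʳ y) f ⟩
  ∑ (shuffle (p ∷ʳ x) ((b ∷ q) ∷ʳ y)) (f ∘ (a ∷_)) + ∑ (shuffle ((a ∷ p) ∷ʳ x) (q ∷ʳ y)) (f ∘ (b ∷_))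
    ≡⟨ cong₂ _+_ (∑-shuffle-∷ʳ-∷ʳ p (b ∷ q) x y (f ∘ (a ∷_)))
                 (∑-shuffle-∷ʳ-∷ʳ (a ∷ p) q x y (f ∘ (b ∷_))) ⟩
  (P + Q) + (R + S)
    ≡⟨ +-interchange P Q R S ⟩
  (P + R) + (Q + S)
    ≡⟨ cong₂ _+_ (∑-shuffle-∷-∷ a p b (q ∷ʳ y) (f ∘ (_∷ʳ x)))
                 (∑-shuffle-∷-∷ a (p ∷ʳ x) b q (f ∘ (_∷ʳ y))) ⟨
  ∑ (shuffle (a ∷ p) ((b ∷ q) ∷ʳ y)) (f ∘ (_∷ʳ x)) + ∑ (shuffle ((a ∷ p) ∷ʳ x) (b ∷ q)) (f ∘ (_∷ʳ y)) ∎
  where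
  P = ∑ (shuffle p ((b ∷ q) ∷ʳ y)) (f ∘ (a ∷_) ∘ (_∷ʳ x))
  Q = ∑ (shuffle (p ∷ʳ x) (b ∷ q)) (f ∘ (a ∷_) ∘ (_∷ʳ y))
  R = ∑ (shuffle (a ∷ p) (q ∷ʳ y)) (f ∘ (b ∷_) ∘ (_∷ʳ x))
  S = ∑ (shuffle ((a ∷ p) ∷ʳ x) q) (f ∘ (b ∷_) ∘ (_∷ʳ y))

module _ (f : List ℕ → ℕ) (f-[] : f [] ≡ 0) (f-∷ : ∀ a γ → f (a ∷ γ) ≡ f (a ∷ []) ℕ.+ f γ) where

  shuffle-additive : ∀ α β → All (λ γ → f γ ≡ f α ℕ.+ f β) (shuffle α β)
  shuffle-additive []      β       = cong (ℕ._+ f β) (sym f-[]) ∷ []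
  shuffle-additive (a ∷ α) []      = sym (trans (cong (f (a ∷ α) ℕ.+_) f-[]) (ℕ.+-identityʳ (f (a ∷ α)))) ∷ []
  shuffle-additive (a ∷ α) (b ∷ β) =
    All.++⁺ (All.map⁺ (All.map prepend-a (shuffle-additive α (b ∷ β))))
            (All.map⁺ (All.map prepend-b (shuffle-additive (a ∷ α) β)))
    where
    prepend-a : ∀ {γ} → f γ ≡ f α ℕ.+ f (b ∷ β) → f (a ∷ γ) ≡ f (a ∷ α) ℕ.+ f (b ∷ β)
    prepend-a {γ} eq = begin
      f (a ∷ γ)                              ≡⟨ f-∷ a γ ⟩
      f (a ∷ []) ℕ.+ f γ                     ≡⟨ cong (f (a ∷ []) ℕ.+_) eq ⟩
      f (a ∷ []) ℕ.+ (f α ℕ.+ f (b ∷ β))     ≡⟨ ℕ.+-assoc (f (a ∷ [])) (f α) (f (b ∷ β)) ⟨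
      (f (a ∷ []) ℕ.+ f α) ℕ.+ f (b ∷ β)     ≡⟨ cong (ℕ._+ f (b ∷ β)) (f-∷ a α) ⟨
      f (a ∷ α) ℕ.+ f (b ∷ β)                ∎
    prepend-b : ∀ {γ} → f γ ≡ f (a ∷ α) ℕ.+ f β → f (b ∷ γ) ≡ f (a ∷ α) ℕ.+ f (b ∷ β)
    prepend-b {γ} eq = begin
      f (b ∷ γ)                              ≡⟨ f-∷ b γ ⟩
      f (b ∷ []) ℕ.+ f γ                     ≡⟨ cong (f (b ∷ []) ℕ.+_) eq ⟩
      f (b ∷ []) ℕ.+ (f (a ∷ α) ℕ.+ f β)     ≡⟨ left-comm (f (b ∷ [])) (f (a ∷ α)) (f β) ⟩
      f (a ∷ α) ℕ.+ (f (b ∷ []) ℕ.+ f β)     ≡⟨ cong (f (a ∷ α) ℕ.+_) (f-∷ b β) ⟨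
      f (a ∷ α) ℕ.+ f (b ∷ β)                ∎
      where
      left-comm : ∀ x y z → x ℕ.+ (y ℕ.+ z) ≡ y ℕ.+ (x ℕ.+ z)
      left-comm = solve-∀

size-shuffle : ∀ α β → All (λ γ → size γ ≡ size α ℕ.+ size β) (shuffle α β)
size-shuffle = shuffle-additive size refl (λ a γ → cong (ℕ._+ size γ) (sym (ℕ.+-identityʳ a)))

mult-∷ : ∀ i a γ → mult i (a ∷ γ) ≡ mult i (a ∷ []) ℕ.+ mult i γ
mult-∷ i a γ with i ℕ.≟ a
... | yes _ = refl
... | no  _ = refl

mult-shuffle : ∀ i α β → All (λ γ → mult i γ ≡ mult i α ℕ.+ mult i β) (shuffle α β)
mult-shuffle i = shuffle-additive (mult i) refl (mult-∷ i)

size-∷ʳ : ∀ r g → size (r ∷ʳ g) ≡ size r ℕ.+ g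
size-∷ʳ []      g = ℕ.+-identityʳ g
size-∷ʳ (a ∷ r) g = trans (cong (a ℕ.+_) (size-∷ʳ r g)) (sym (ℕ.+-assoc a (size r) g))

-- Deconcatenation commutes with shuffling

splits : {A : Set} → List A → List (List A × List A)
splits []       = ([] , []) ∷ []
splits (a ∷ as) = ([] , a ∷ as) ∷ map (map₁ (a ∷_)) (splits as)

module _ {A : Set} where

  ∑-splits-∷ : ∀ a (as : List A) (G : List A × List A → ℚ) →
    ∑ (splits (a ∷ as)) G ≡ G ([] , a ∷ as) + ∑ (splits as) (G ∘ map₁ (a ∷_))
  ∑-splits-∷ a as G = cong (G ([] , a ∷ as) +_) (∑-map (map₁ (a ∷_)) (splits as) G)

  splits-All : ∀ {P : A → Set} {as} → All P as → All (λ ps → All P (proj₁ ps) × All P (proj₂ ps)) (splits as)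
  splits-All []         = ([] , []) ∷ []
  splits-All (pa ∷ pas) = ([] , pa ∷ pas) ∷ All.map⁺ (All.map (map₁ (pa ∷_)) (splits-All pas))

  ∑splits : (List A → List A → ℚ) → List A → ℚ
  ∑splits F γ = ∑ (splits γ) (uncurry F)

∑shuffle² : (List ℕ → List ℕ → ℚ) → List ℕ × List ℕ → List ℕ × List ℕ → ℚ
∑shuffle² F (p , s) (q , t) = ∑ (shuffle p q) (λ r → ∑ (shuffle s t) (F r))

∑splits² : (List ℕ → List ℕ → ℚ) → List ℕ → List ℕ → ℚ
∑splits² F α β = ∑ (splits α) (λ ps → ∑ (splits β) (∑shuffle² F ps))

module _ (F : List ℕ → List ℕ → ℚ) where

  ∑shuffle²-[]-[] : ∀ α β → ∑shuffle² F ([] , α) ([] , β) ≡ ∑ (shuffle α β) (F [])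
  ∑shuffle²-[]-[] α β = +-identityʳ (∑ (shuffle α β) (F []))

  ∑shuffle²-∷-[] : ∀ a p s β → ∑shuffle² F (a ∷ p , s) ([] , β) ≡ ∑shuffle² (F ∘ (a ∷_)) (p , s) ([] , β)
  ∑shuffle²-∷-[] a p s β = cong (λ sh → ∑ sh (λ r → ∑ (shuffle s β) (F (a ∷ r)))) (sym (shuffle-[]ʳ p))

  ∑shuffle²-∷-∷ : ∀ a p s b q t → ∑shuffle² F (a ∷ p , s) (b ∷ q , t) ≡
    ∑shuffle² (F ∘ (a ∷_)) (p , s) (b ∷ q , t) + ∑shuffle² (F ∘ (b ∷_)) (a ∷ p , s) (q , t)
  ∑shuffle²-∷-∷ a p s b q t = ∑-shuffle-∷-∷ a p b q (λ r → ∑ (shuffle s t) (F r))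

  ∑shuffle²-unitʳ : ∀ ps → ∑shuffle² F ps ([] , []) ≡ uncurry F ps
  ∑shuffle²-unitʳ (p , s) rewrite shuffle-[]ʳ p | shuffle-[]ʳ s = trans (+-identityʳ _) (+-identityʳ (F p s))

∑-shuffle-∑splits-∷-∷ : ∀ a α b β F → ∑ (shuffle (a ∷ α) (b ∷ β)) (∑splits F) ≡
  ∑ (shuffle (a ∷ α) (b ∷ β)) (F []) +
  (∑ (shuffle α (b ∷ β)) (∑splits (F ∘ (a ∷_))) + ∑ (shuffle (a ∷ α) β) (∑splits (F ∘ (b ∷_))))
∑-shuffle-∑splits-∷-∷ a α b β F = begin
  ∑ (shuffle (a ∷ α) (b ∷ β)) (∑splits F)
    ≡⟨ ∑-shuffle-∷-∷ a α b β (∑splits F) ⟩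
  ∑ (shuffle α (b ∷ β)) (∑splits F ∘ (a ∷_)) + ∑ (shuffle (a ∷ α) β) (∑splits F ∘ (b ∷_))
    ≡⟨ cong₂ _+_ (peel a (shuffle α (b ∷ β))) (peel b (shuffle (a ∷ α) β)) ⟩
  (X₁ + L₁) + (X₂ + L₂)
    ≡⟨ +-interchange X₁ L₁ X₂ L₂ ⟩
  (X₁ + X₂) + (L₁ + L₂)
    ≡⟨ cong (_+ (L₁ + L₂)) (∑-shuffle-∷-∷ a α b β (F [])) ⟨
  ∑ (shuffle (a ∷ α) (b ∷ β)) (F []) + (L₁ + L₂) ∎
  where
  peel : ∀ c γs → ∑ γs (∑splits F ∘ (c ∷_)) ≡ ∑ γs (F [] ∘ (c ∷_)) + ∑ γs (∑splits (F ∘ (c ∷_)))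
  peel c γs = trans (∑-cong γs (λ γ → ∑-splits-∷ c γ (uncurry F))) (∑-+ γs _ _)
  X₁ = ∑ (shuffle α (b ∷ β)) (F [] ∘ (a ∷_))
  X₂ = ∑ (shuffle (a ∷ α) β) (F [] ∘ (b ∷_))
  L₁ = ∑ (shuffle α (b ∷ β)) (∑splits (F ∘ (a ∷_)))
  L₂ = ∑ (shuffle (a ∷ α) β) (∑splits (F ∘ (b ∷_)))

∑splits²-∷-∷ : ∀ a α b β F → ∑splits² F (a ∷ α) (b ∷ β) ≡
  ∑ (shuffle (a ∷ α) (b ∷ β)) (F []) + (∑splits² (F ∘ (a ∷_)) α (b ∷ β) + ∑splits² (F ∘ (b ∷_)) (a ∷ α) β)
∑splits²-∷-∷ a α b β F = begin
  ∑splits² F (a ∷ α) (b ∷ β)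
    ≡⟨ ∑-splits-∷ a α (λ ps → ∑ (splits (b ∷ β)) (∑shuffle² F ps)) ⟩
  ∑ (splits (b ∷ β)) (∑shuffle² F ([] , a ∷ α)) +
  ∑ (splits α) (λ ps → ∑ (splits (b ∷ β)) (∑shuffle² F (map₁ (a ∷_) ps)))
    ≡⟨ cong₂ _+_ first-row other-rows ⟩
  (X + Y) + (A + (B₁ + B₂))
    ≡⟨ solve 5 (λ X Y A B₁ B₂ → (X :+ Y) :+ (A :+ (B₁ :+ B₂)) := X :+ ((A :+ B₁) :+ (Y :+ B₂))) refl X Y A B₁ B₂ ⟩
  X + ((A + B₁) + (Y + B₂))
    ≡⟨ cong (X +_) (cong₂ _+_ Fa-rows Fb-rows) ⟨
  X + (∑splits² Fa α (b ∷ β) + ∑splits² Fb (a ∷ α) β) ∎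
  where
  open +-*-Solver
  Fa Fb : List ℕ → List ℕ → ℚ
  Fa = F ∘ (a ∷_)
  Fb = F ∘ (b ∷_)
  B₁-row B₂-row : List ℕ × List ℕ → ℚ
  B₁-row ps = ∑ (splits β) (∑shuffle² Fa ps ∘ map₁ (b ∷_))
  B₂-row ps = ∑ (splits β) (∑shuffle² Fb (map₁ (a ∷_) ps))
  X = ∑ (shuffle (a ∷ α) (b ∷ β)) (F [])
  Y = ∑ (splits β) (∑shuffle² Fb ([] , a ∷ α))
  A = ∑ (splits α) (λ ps → ∑shuffle² Fa ps ([] , b ∷ β))
  B₁ = ∑ (splits α) B₁-row
  B₂ = ∑ (splits α) B₂-row
  first-row : ∑ (splits (b ∷ β)) (∑shuffle² F ([] , a ∷ α)) ≡ X + Y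
  first-row = trans (∑-splits-∷ b β (∑shuffle² F ([] , a ∷ α))) (cong (_+ Y) (∑shuffle²-[]-[] F (a ∷ α) (b ∷ β)))
  row : ∀ ps → ∑ (splits (b ∷ β)) (∑shuffle² F (map₁ (a ∷_) ps)) ≡
    ∑shuffle² Fa ps ([] , b ∷ β) + (B₁-row ps + B₂-row ps)
  row (p , s) = trans (∑-splits-∷ b β (∑shuffle² F (a ∷ p , s)))
    (cong₂ _+_ (∑shuffle²-∷-[] F a p s (b ∷ β))
               (trans (∑-cong (splits β) (λ qt → ∑shuffle²-∷-∷ F a p s b (proj₁ qt) (proj₂ qt)))
                      (∑-+ (splits β) (∑shuffle² Fa (p , s) ∘ map₁ (b ∷_)) (∑shuffle² Fb (a ∷ p , s)))))
  other-rows : ∑ (splits α) (λ ps → ∑ (splits (b ∷ β)) (∑shuffle² F (map₁ (a ∷_) ps))) ≡ A + (B₁ + B₂)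
  other-rows = begin
    ∑ (splits α) (λ ps → ∑ (splits (b ∷ β)) (∑shuffle² F (map₁ (a ∷_) ps)))
      ≡⟨ ∑-cong (splits α) row ⟩
    ∑ (splits α) (λ ps → ∑shuffle² Fa ps ([] , b ∷ β) + (B₁-row ps + B₂-row ps))
      ≡⟨ ∑-+ (splits α) _ _ ⟩
    A + ∑ (splits α) (λ ps → B₁-row ps + B₂-row ps)
      ≡⟨ cong (A +_) (∑-+ (splits α) B₁-row B₂-row) ⟩
    A + (B₁ + B₂) ∎
  Fa-rows : ∑splits² Fa α (b ∷ β) ≡ A + B₁
  Fa-rows = trans (∑-cong (splits α) (λ ps → ∑-splits-∷ b β (∑shuffle² Fa ps))) (∑-+ (splits α) _ _)
  Fb-rows : ∑splits² Fb (a ∷ α) β ≡ Y + B₂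
  Fb-rows = ∑-splits-∷ a α (λ ps → ∑ (splits β) (∑shuffle² Fb ps))

∑-shuffle-∑splits : ∀ α β F → ∑ (shuffle α β) (∑splits F) ≡ ∑splits² F α β
∑-shuffle-∑splits []      β       F =
  cong (_+ 0ℚ) (∑-cong (splits β) (λ qt → sym (trans (+-identityʳ _) (+-identityʳ (uncurry F qt)))))
∑-shuffle-∑splits (a ∷ α) []      F =
  trans (+-identityʳ _) (∑-cong (splits (a ∷ α)) (λ ps → sym (trans (+-identityʳ _) (∑shuffle²-unitʳ F ps))))
∑-shuffle-∑splits (a ∷ α) (b ∷ β) F = begin
  ∑ (shuffle (a ∷ α) (b ∷ β)) (∑splits F)
    ≡⟨ ∑-shuffle-∑splits-∷-∷ a α b β F ⟩
  X + (∑ (shuffle α (b ∷ β)) (∑splits (F ∘ (a ∷_))) + ∑ (shuffle (a ∷ α) β) (∑splits (F ∘ (b ∷_))))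
    ≡⟨ cong (X +_) (cong₂ _+_ (∑-shuffle-∑splits α (b ∷ β) (F ∘ (a ∷_)))
                              (∑-shuffle-∑splits (a ∷ α) β (F ∘ (b ∷_)))) ⟩
  X + (∑splits² (F ∘ (a ∷_)) α (b ∷ β) + ∑splits² (F ∘ (b ∷_)) (a ∷ α) β)
    ≡⟨ ∑splits²-∷-∷ a α b β F ⟨
  ∑splits² F (a ∷ α) (b ∷ β) ∎
  where X = ∑ (shuffle (a ∷ α) (b ∷ β)) (F [])

-- The normalised power sums ψ α = Ψ α / z α

∑-blockings-∷ : ∀ a as (G : List (List ℕ) → ℚ) →
  ∑ (blockings (a ∷ as)) G ≡ ∑ (splits as) (λ ps → ∑ (blockings (proj₂ ps)) (λ bs → G ((a ∷ proj₁ ps) ∷ bs)))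
∑-blockings-∷ a []        G = sym (+-identityʳ _)
∑-blockings-∷ a (a₂ ∷ as) G = begin
  ∑ (blockings (a ∷ a₂ ∷ as)) G
    ≡⟨ trans (∑-concatMap _ (blockings (a₂ ∷ as)) G)
             (∑-cong (blockings (a₂ ∷ as)) λ { [] → refl
                                            ; (b ∷ bs) → cong (separate-a (b ∷ bs) +_) (+-identityʳ (join-a (b ∷ bs))) }) ⟩
  ∑ (blockings (a₂ ∷ as)) (λ cs → separate-a cs + join-a cs)
    ≡⟨ ∑-+ (blockings (a₂ ∷ as)) separate-a join-a ⟩
  ∑ (blockings (a₂ ∷ as)) separate-a + ∑ (blockings (a₂ ∷ as)) join-a
    ≡⟨ cong (∑ (blockings (a₂ ∷ as)) separate-a +_) (∑-blockings-∷ a₂ as join-a) ⟩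
  ∑ (blockings (a₂ ∷ as)) separate-a +
  ∑ (splits as) (λ ps → ∑ (blockings (proj₂ ps)) (λ bs → G ((a ∷ a₂ ∷ proj₁ ps) ∷ bs)))
    ≡⟨ ∑-splits-∷ a₂ as (λ ps → ∑ (blockings (proj₂ ps)) (λ bs → G ((a ∷ proj₁ ps) ∷ bs))) ⟨
  ∑ (splits (a₂ ∷ as)) (λ ps → ∑ (blockings (proj₂ ps)) (λ bs → G ((a ∷ proj₁ ps) ∷ bs))) ∎
  where
  separate-a join-a : List (List ℕ) → ℚ
  separate-a cs = G ((a ∷ []) ∷ cs)
  -- the value at [] is irrelevant: blockings of a nonempty list have a first block
  join-a []       = 0ℚ
  join-a (b ∷ bs) = G ((a ∷ b) ∷ bs)

1/π : List ℕ → ℚ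
1/π γ = inv (πc γ)

ψ : List ℕ → List ℚ → ℚ
ψ α xs = ∑ (blockings α) (λ bs → inv (πblocks bs) * M (map size bs) xs)

ψ-∷-term : ℚ → List ℚ → List ℕ → List ℕ → ℚ
ψ-∷-term x xs p s = (1/π p * x ^q size p) * ψ s xs

δ[] : List ℕ → ℚ
δ[] []      = 1ℚ
δ[] (_ ∷ _) = 0ℚ

ψ-[] : ∀ α → ψ α [] ≡ δ[] α
ψ-[] []       = refl
ψ-[] (a ∷ as) = trans (∑-blockings-∷ a as _)
  (∑-zero (splits as) (λ ps → ∑-zero (blockings (proj₂ ps)) (λ bs → *-zeroʳ (inv (πblocks ((a ∷ proj₁ ps) ∷ bs))))))

∑-shuffle-δ[] : ∀ α β → ∑ (shuffle α β) δ[] ≡ δ[] α * δ[] β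
∑-shuffle-δ[] []      β       = trans (+-identityʳ (δ[] β)) (sym (*-identityˡ (δ[] β)))
∑-shuffle-δ[] (a ∷ α) []      = refl
∑-shuffle-δ[] (a ∷ α) (b ∷ β) = trans (∑-shuffle-∷-∷ a α b β δ[])
  (cong₂ _+_ (∑-zero (shuffle α (b ∷ β)) (λ _ → refl)) (∑-zero (shuffle (a ∷ α) β) (λ _ → refl)))

ψ-∷ : ∀ x xs α → ψ α (x ∷ xs) ≡ ∑splits (ψ-∷-term x xs) α
ψ-∷ x xs []       = refl
ψ-∷ x xs (a ∷ as) = begin
  ψ (a ∷ as) (x ∷ xs)
    ≡⟨ ∑-blockings-∷ a as _ ⟩
  ∑ (splits as) (λ ps → ∑ (blockings (proj₂ ps))
                          (λ bs → w ps bs * (x ^q n ps * M (map size bs) xs + M (n ps ∷ map size bs) xs)))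
    ≡⟨ ∑-cong (splits as) (λ ps → trans (∑-cong (blockings (proj₂ ps)) (λ bs → *-distribˡ-+ (w ps bs) _ _))
                                        (∑-+ (blockings (proj₂ ps)) (uses-x ps) (avoids-x ps))) ⟩
  ∑ (splits as) (λ ps → ∑uses-x ps + ∑avoids-x ps)
    ≡⟨ ∑-+ (splits as) ∑uses-x ∑avoids-x ⟩
  ∑ (splits as) ∑uses-x + ∑ (splits as) ∑avoids-x
    ≡⟨ cong₂ _+_ (∑-cong (splits as) factor-uses-x) (sym (∑-blockings-∷ a as _)) ⟩
  ∑ (splits as) (uncurry F ∘ map₁ (a ∷_)) + ψ (a ∷ as) xs
    ≡⟨ +-comm _ (ψ (a ∷ as) xs) ⟩
  ψ (a ∷ as) xs + ∑ (splits as) (uncurry F ∘ map₁ (a ∷_))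
    ≡⟨ cong (_+ ∑ (splits as) (uncurry F ∘ map₁ (a ∷_))) (*-identityˡ (ψ (a ∷ as) xs)) ⟨
  F [] (a ∷ as) + ∑ (splits as) (uncurry F ∘ map₁ (a ∷_))
    ≡⟨ ∑-splits-∷ a as (uncurry F) ⟨
  ∑splits F (a ∷ as) ∎
  where
  F = ψ-∷-term x xs
  n : List ℕ × List ℕ → ℕ
  n ps = size (a ∷ proj₁ ps)
  w uses-x avoids-x : List ℕ × List ℕ → List (List ℕ) → ℚ
  w ps bs = inv (πc (a ∷ proj₁ ps) ℕ.* πblocks bs)
  uses-x ps bs = w ps bs * (x ^q n ps * M (map size bs) xs)
  avoids-x ps bs = w ps bs * M (n ps ∷ map size bs) xs
  ∑uses-x ∑avoids-x : List ℕ × List ℕ → ℚ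
  ∑uses-x ps = ∑ (blockings (proj₂ ps)) (uses-x ps)
  ∑avoids-x ps = ∑ (blockings (proj₂ ps)) (avoids-x ps)
  factor-uses-x : ∀ ps → ∑uses-x ps ≡ uncurry F (map₁ (a ∷_) ps)
  factor-uses-x ps@(p , s) = begin
    ∑ (blockings s) (uses-x ps)
      ≡⟨ ∑-cong (blockings s) (λ bs → cong (_* (x ^q n ps * M (map size bs) xs)) (inv-* (πc (a ∷ p)) (πblocks bs))) ⟩
    ∑ (blockings s) (λ bs → (1/π (a ∷ p) * inv (πblocks bs)) * (x ^q n ps * M (map size bs) xs))
      ≡⟨ ∑-cong (blockings s) (λ bs → *-interchange (1/π (a ∷ p)) (inv (πblocks bs)) (x ^q n ps) (M (map size bs) xs)) ⟩
    ∑ (blockings s) (λ bs → (1/π (a ∷ p) * x ^q n ps) * (inv (πblocks bs) * M (map size bs) xs))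
      ≡⟨ *-distribˡ-∑ (1/π (a ∷ p) * x ^q n ps) (blockings s) (λ bs → inv (πblocks bs) * M (map size bs) xs) ⟨
    F (a ∷ p) s ∎

piAux-∷ʳ : ∀ s r g → piAux s (r ∷ʳ g) ≡ piAux s r ℕ.* (s ℕ.+ size r ℕ.+ g)
piAux-∷ʳ s []      g = last-factor s g
  where
  last-factor : ∀ s g → (s ℕ.+ g) ℕ.* 1 ≡ 1 ℕ.* (s ℕ.+ 0 ℕ.+ g)
  last-factor = solve-∀
piAux-∷ʳ s (a ∷ r) g = begin
  (s ℕ.+ a) ℕ.* piAux (s ℕ.+ a) (r ∷ʳ g)
    ≡⟨ cong ((s ℕ.+ a) ℕ.*_) (piAux-∷ʳ (s ℕ.+ a) r g) ⟩
  (s ℕ.+ a) ℕ.* (piAux (s ℕ.+ a) r ℕ.* (s ℕ.+ a ℕ.+ size r ℕ.+ g))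
    ≡⟨ reassociate s a (piAux (s ℕ.+ a) r) (size r) g ⟩
  (s ℕ.+ a) ℕ.* piAux (s ℕ.+ a) r ℕ.* (s ℕ.+ (a ℕ.+ size r) ℕ.+ g) ∎
  where
  reassociate : ∀ s a P R g →
    (s ℕ.+ a) ℕ.* (P ℕ.* (s ℕ.+ a ℕ.+ R ℕ.+ g)) ≡ (s ℕ.+ a) ℕ.* P ℕ.* (s ℕ.+ (a ℕ.+ R) ℕ.+ g)
  reassociate = solve-∀

1/π-∷ʳ : ∀ r g → 1/π (r ∷ʳ g) ≡ 1/π r * inv (size r ℕ.+ g)
1/π-∷ʳ r g = trans (cong inv (piAux-∷ʳ 0 r g)) (inv-* (πc r) (size r ℕ.+ g))

∑1/π∷ʳ-shuffle : ∀ p q g → ∑ (shuffle p q) (1/π ∘ (_∷ʳ g)) ≡ ∑ (shuffle p q) 1/π * inv (size p ℕ.+ size q ℕ.+ g)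
∑1/π∷ʳ-shuffle p q g = begin
  ∑ (shuffle p q) (1/π ∘ (_∷ʳ g))
    ≡⟨ ∑-cong-All (All.map (λ {r} size-r → trans (1/π-∷ʳ r g) (cong (λ m → 1/π r * inv (m ℕ.+ g)) size-r))
                           (size-shuffle p q)) ⟩
  ∑ (shuffle p q) (λ r → 1/π r * inv N)
    ≡⟨ *-distribʳ-∑ (inv N) (shuffle p q) 1/π ⟨
  ∑ (shuffle p q) 1/π * inv N ∎
  where N = size p ℕ.+ size q ℕ.+ g

∑1/π-shuffle-∷ʳ-∷ʳ : ∀ p q x y .{{_ : NonZero x}} .{{_ : NonZero y}} →
  ∑ (shuffle p (q ∷ʳ y)) 1/π ≡ 1/π p * 1/π (q ∷ʳ y) →
  ∑ (shuffle (p ∷ʳ x) q) 1/π ≡ 1/π (p ∷ʳ x) * 1/π q →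
  ∑ (shuffle (p ∷ʳ x) (q ∷ʳ y)) 1/π ≡ 1/π (p ∷ʳ x) * 1/π (q ∷ʳ y)
∑1/π-shuffle-∷ʳ-∷ʳ p q x y IH-x IH-y = begin
  ∑ (shuffle (p ∷ʳ x) (q ∷ʳ y)) 1/π
    ≡⟨ ∑-shuffle-∷ʳ-∷ʳ p q x y 1/π ⟩
  ∑ (shuffle p (q ∷ʳ y)) (1/π ∘ (_∷ʳ x)) + ∑ (shuffle (p ∷ʳ x) q) (1/π ∘ (_∷ʳ y))
    ≡⟨ cong₂ _+_ (∑1/π∷ʳ-shuffle p (q ∷ʳ y) x) (∑1/π∷ʳ-shuffle (p ∷ʳ x) q y) ⟩
  ∑ (shuffle p (q ∷ʳ y)) 1/π * inv (size p ℕ.+ size (q ∷ʳ y) ℕ.+ x) +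
  ∑ (shuffle (p ∷ʳ x) q) 1/π * inv (size (p ∷ʳ x) ℕ.+ size q ℕ.+ y)
    ≡⟨ cong₂ _+_ (cong₂ _*_ IH-x (cong inv size-x)) (cong₂ _*_ IH-y (cong inv size-y)) ⟩
  (1/π p * 1/π (q ∷ʳ y)) * inv (A ℕ.+ B) + (1/π (p ∷ʳ x) * 1/π q) * inv (A ℕ.+ B)
    ≡⟨ cong₂ (λ u v → (1/π p * u) * inv (A ℕ.+ B) + (v * 1/π q) * inv (A ℕ.+ B)) (1/π-∷ʳ q y) (1/π-∷ʳ p x) ⟩
  (1/π p * (1/π q * inv B)) * inv (A ℕ.+ B) + ((1/π p * inv A) * 1/π q) * inv (A ℕ.+ B)
    ≡⟨ solve 5 (λ πp πq iA iB iN → (πp :* (πq :* iB)) :* iN :+ ((πp :* iA) :* πq) :* iN := (πp :* πq) :* (iN :* (iA :+ iB)))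
               refl (1/π p) (1/π q) (inv A) (inv B) (inv (A ℕ.+ B)) ⟩
  (1/π p * 1/π q) * (inv (A ℕ.+ B) * (inv A + inv B))
    ≡⟨ cong (1/π p * 1/π q *_) (inv-+ A B {{nonZero-+ʳ (size p) x}} {{nonZero-+ʳ (size q) y}}) ⟩
  (1/π p * 1/π q) * (inv A * inv B)
    ≡⟨ *-interchange (1/π p) (1/π q) (inv A) (inv B) ⟩
  (1/π p * inv A) * (1/π q * inv B)
    ≡⟨ cong₂ _*_ (1/π-∷ʳ p x) (1/π-∷ʳ q y) ⟨
  1/π (p ∷ʳ x) * 1/π (q ∷ʳ y) ∎
  where
  open +-*-Solver
  A = size p ℕ.+ x
  B = size q ℕ.+ y
  size-x : size p ℕ.+ size (q ∷ʳ y) ℕ.+ x ≡ A ℕ.+ B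
  size-x = trans (cong (λ m → size p ℕ.+ m ℕ.+ x) (size-∷ʳ q y)) (move-x (size p) (size q) y x)
    where
    move-x : ∀ P Q y x → P ℕ.+ (Q ℕ.+ y) ℕ.+ x ≡ P ℕ.+ x ℕ.+ (Q ℕ.+ y)
    move-x = solve-∀
  size-y : size (p ∷ʳ x) ℕ.+ size q ℕ.+ y ≡ A ℕ.+ B
  size-y = trans (cong (λ m → m ℕ.+ size q ℕ.+ y) (size-∷ʳ p x)) (ℕ.+-assoc A (size q) y)

∑1/π-shuffle : ∀ {p q} → IsComposition p → IsComposition q → ∑ (shuffle p q) 1/π ≡ 1/π p * 1/π q
∑1/π-shuffle {p} {q} = by-last-parts (reverseView p) (reverseView q)
  where
  by-last-parts : ∀ {p q} → Reverse p → Reverse q → IsComposition p → IsComposition q →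
    ∑ (shuffle p q) 1/π ≡ 1/π p * 1/π q
  by-last-parts {q = q} [] _ _ _ = trans (+-identityʳ (1/π q)) (sym (*-identityˡ (1/π q)))
  by-last-parts (p ∶ _ ∶ʳ x) [] _ _ =
    trans (cong (λ sh → ∑ sh 1/π) (shuffle-[]ʳ (p ∷ʳ x)))
          (trans (+-identityʳ (1/π (p ∷ʳ x))) (sym (*-identityʳ (1/π (p ∷ʳ x)))))
  by-last-parts (p ∶ rp ∶ʳ x) (q ∶ rq ∶ʳ y) cpx cqy =
    let (cp , x>0) = All.∷ʳ⁻ cpx
        (cq , y>0) = All.∷ʳ⁻ cqy
    in ∑1/π-shuffle-∷ʳ-∷ʳ p q x y {{ℕ.>-nonZero x>0}} {{ℕ.>-nonZero y>0}}
         (by-last-parts rp (q ∶ rq ∶ʳ y) cp cqy) (by-last-parts (p ∶ rp ∶ʳ x) rq cpx cq)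

∑1/π*x^size-shuffle : ∀ x {p q} → IsComposition p → IsComposition q →
  ∑ (shuffle p q) (λ r → 1/π r * x ^q size r) ≡ (1/π p * x ^q size p) * (1/π q * x ^q size q)
∑1/π*x^size-shuffle x {p} {q} cp cq = begin
  ∑ (shuffle p q) (λ r → 1/π r * x ^q size r)
    ≡⟨ ∑-cong-All (All.map (λ {r} size-r → cong (λ m → 1/π r * x ^q m) size-r) (size-shuffle p q)) ⟩
  ∑ (shuffle p q) (λ r → 1/π r * x ^q (size p ℕ.+ size q))
    ≡⟨ *-distribʳ-∑ (x ^q (size p ℕ.+ size q)) (shuffle p q) 1/π ⟨
  ∑ (shuffle p q) 1/π * x ^q (size p ℕ.+ size q)
    ≡⟨ cong₂ _*_ (∑1/π-shuffle cp cq) (^q-+ x (size p) (size q)) ⟩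
  (1/π p * 1/π q) * (x ^q size p * x ^q size q)
    ≡⟨ *-interchange (1/π p) (1/π q) (x ^q size p) (x ^q size q) ⟩
  (1/π p * x ^q size p) * (1/π q * x ^q size q) ∎

ψ-shuffle : ∀ xs {α β} → IsComposition α → IsComposition β → ψ α xs * ψ β xs ≡ ∑ (shuffle α β) (λ γ → ψ γ xs)
ψ-shuffle [] {α} {β} _ _ = begin
  ψ α [] * ψ β []                    ≡⟨ cong₂ _*_ (ψ-[] α) (ψ-[] β) ⟩
  δ[] α * δ[] β                      ≡⟨ ∑-shuffle-δ[] α β ⟨
  ∑ (shuffle α β) δ[]                ≡⟨ ∑-cong (shuffle α β) ψ-[] ⟨
  ∑ (shuffle α β) (λ γ → ψ γ [])     ∎
ψ-shuffle (x ∷ xs) {α} {β} cα cβ = begin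
  ψ α (x ∷ xs) * ψ β (x ∷ xs)
    ≡⟨ cong₂ _*_ (ψ-∷ x xs α) (ψ-∷ x xs β) ⟩
  ∑splits F α * ∑splits F β
    ≡⟨ ∑-*-∑ (splits α) (splits β) (uncurry F) (uncurry F) ⟩
  ∑ (splits α) (λ ps → ∑ (splits β) (λ qt → uncurry F ps * uncurry F qt))
    ≡⟨ ∑-cong-All (All.map (λ cps → ∑-cong-All (All.map (product-of-terms cps) (splits-All cβ))) (splits-All cα)) ⟩
  ∑splits² F α β
    ≡⟨ ∑-shuffle-∑splits α β F ⟨
  ∑ (shuffle α β) (∑splits F)
    ≡⟨ ∑-cong (shuffle α β) (ψ-∷ x xs) ⟨
  ∑ (shuffle α β) (λ γ → ψ γ (x ∷ xs)) ∎
  where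
  F = ψ-∷-term x xs
  Compositions : List ℕ × List ℕ → Set
  Compositions ps = IsComposition (proj₁ ps) × IsComposition (proj₂ ps)
  product-of-terms : ∀ {ps qt} → Compositions ps → Compositions qt → uncurry F ps * uncurry F qt ≡ ∑shuffle² F ps qt
  product-of-terms {p , s} {q , t} (cp , cs) (cq , ct) = begin
    ((1/π p * x ^q size p) * ψ s xs) * ((1/π q * x ^q size q) * ψ t xs)
      ≡⟨ *-interchange (1/π p * x ^q size p) (ψ s xs) (1/π q * x ^q size q) (ψ t xs) ⟩
    ((1/π p * x ^q size p) * (1/π q * x ^q size q)) * (ψ s xs * ψ t xs)
      ≡⟨ cong₂ _*_ (∑1/π*x^size-shuffle x cp cq) (sym (ψ-shuffle xs cs ct)) ⟨
    ∑ (shuffle p q) (λ r → 1/π r * x ^q size r) * ∑ (shuffle s t) (λ δ → ψ δ xs)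
      ≡⟨ ∑-*-∑ (shuffle p q) (shuffle s t) (λ r → 1/π r * x ^q size r) (λ δ → ψ δ xs) ⟩
    ∑shuffle² F (p , s) (q , t) ∎
-- z of a shuffle

[m+n]Cm*m!*n!≡[m+n]! : ∀ m n → ((m ℕ.+ n) C m) ℕ.* (m ! ℕ.* n !) ≡ (m ℕ.+ n) !
[m+n]Cm*m!*n!≡[m+n]! m n = begin
  ((m ℕ.+ n) C m) ℕ.* (m ! ℕ.* n !)
    ≡⟨ cong (λ k → ((m ℕ.+ n) C m) ℕ.* (m ! ℕ.* k !)) (ℕ.m+n∸m≡n m n) ⟨
  ((m ℕ.+ n) C m) ℕ.* (m ! ℕ.* (m ℕ.+ n ℕ.∸ m) !)
    ≡⟨ cong (ℕ._* (m ! ℕ.* (m ℕ.+ n ℕ.∸ m) !)) (nCk≡n!/k![n-k]! (ℕ.m≤m+n m n)) ⟩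
  ((m ℕ.+ n) ! ℕ./ (m ! ℕ.* (m ℕ.+ n ℕ.∸ m) !)) {{ℕ._!*_!≢0 m (m ℕ.+ n ℕ.∸ m)}}
    ℕ.* (m ! ℕ.* (m ℕ.+ n ℕ.∸ m) !)
    ≡⟨ m/n*n≡m {{ℕ._!*_!≢0 m (m ℕ.+ n ℕ.∸ m)}} (k![n∸k]!∣n! (ℕ.m≤m+n m n)) ⟩
  (m ℕ.+ n) ! ∎

binomial-nonZero : ∀ m n → NonZero ((m ℕ.+ n) C m)
binomial-nonZero m n =
  ℕ.m*n≢0⇒m≢0 ((m ℕ.+ n) C m) {{subst NonZero (sym ([m+n]Cm*m!*n!≡[m+n]! m n)) (ℕ._!≢0 (m ℕ.+ n))}}

z-factor : ℕ → ℕ → ℕ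
z-factor i m = i ℕ.^ m ℕ.* m !

z-factor-+ : ∀ i m n → z-factor i (m ℕ.+ n) ≡ z-factor i m ℕ.* z-factor i n ℕ.* ((m ℕ.+ n) C m)
z-factor-+ i m n = begin
  i ℕ.^ (m ℕ.+ n) ℕ.* (m ℕ.+ n) !
    ≡⟨ cong₂ ℕ._*_ (ℕ.^-distribˡ-+-* i m n) (sym ([m+n]Cm*m!*n!≡[m+n]! m n)) ⟩
  (i ℕ.^ m ℕ.* i ℕ.^ n) ℕ.* (((m ℕ.+ n) C m) ℕ.* (m ! ℕ.* n !))
    ≡⟨ regroup (i ℕ.^ m) (i ℕ.^ n) ((m ℕ.+ n) C m) (m !) (n !) ⟩
  z-factor i m ℕ.* z-factor i n ℕ.* ((m ℕ.+ n) C m) ∎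
  where
  regroup : ∀ a b c u v → (a ℕ.* b) ℕ.* (c ℕ.* (u ℕ.* v)) ≡ a ℕ.* u ℕ.* (b ℕ.* v) ℕ.* c
  regroup = solve-∀

prodℕ-cong : ∀ {f g : ℕ → ℕ} js → (∀ j → f j ≡ g j) → prodℕ (map f js) ≡ prodℕ (map g js)
prodℕ-cong []       f≗g = refl
prodℕ-cong (j ∷ js) f≗g = cong₂ ℕ._*_ (f≗g j) (prodℕ-cong js f≗g)

prodℕ-* : ∀ (f g : ℕ → ℕ) js → prodℕ (map (λ j → f j ℕ.* g j) js) ≡ prodℕ (map f js) ℕ.* prodℕ (map g js)
prodℕ-* f g []       = refl
prodℕ-* f g (j ∷ js) = trans (cong (f j ℕ.* g j ℕ.*_) (prodℕ-* f g js)) (interchange (f j) (g j) _ _)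
  where
  interchange : ∀ a b c d → a ℕ.* b ℕ.* (c ℕ.* d) ≡ a ℕ.* c ℕ.* (b ℕ.* d)
  interchange = solve-∀

prodℕ-nonZero : ∀ (f : ℕ → ℕ) js → (∀ j → NonZero (f j)) → NonZero (prodℕ (map f js))
prodℕ-nonZero f []       f≢0 = _
prodℕ-nonZero f (j ∷ js) f≢0 = ℕ.m*n≢0 (f j) (prodℕ (map f js)) {{f≢0 j}} {{prodℕ-nonZero f js f≢0}}

prodℕ-++ : ∀ ms ns → prodℕ (ms ++ ns) ≡ prodℕ ms ℕ.* prodℕ ns
prodℕ-++ []       ns = sym (ℕ.+-identityʳ (prodℕ ns))
prodℕ-++ (m ∷ ms) ns = trans (cong (m ℕ.*_) (prodℕ-++ ms ns)) (sym (ℕ.*-assoc m (prodℕ ms) (prodℕ ns)))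

Cαβ-nonZero : ∀ α β → NonZero (Cαβ α β)
Cαβ-nonZero α β =
  prodℕ-nonZero _ (upTo (size α ℕ.+ size β)) (λ j → binomial-nonZero (mult (suc j) α) (mult (suc j) β))

size<⇒mult≡0 : ∀ i α → size α ℕ.< i → mult i α ≡ 0
size<⇒mult≡0 i []       _ = refl
size<⇒mult≡0 i (a ∷ as) a+as<i with i ℕ.≟ a
... | yes refl = ⊥-elim (ℕ.n≮n (i ℕ.+ size as) (ℕ.<-≤-trans a+as<i (ℕ.m≤m+n i (size as))))
... | no  _    = size<⇒mult≡0 i as (ℕ.≤-<-trans (ℕ.m≤n+m (size as) a) a+as<i)

zUpTo : ℕ → List ℕ → ℕ
zUpTo N α = prodℕ (map (λ j → z-factor (suc j) (mult (suc j) α)) (upTo N))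

zUpTo-suc : ∀ N α → zUpTo (suc N) α ≡ zUpTo N α ℕ.* z-factor (suc N) (mult (suc N) α)
zUpTo-suc N α = begin
  zUpTo (suc N) α                       ≡⟨ cong (prodℕ ∘ map f) (upTo-∷ʳ N) ⟨
  prodℕ (map f (upTo N ∷ʳ N))           ≡⟨ cong prodℕ (map-++ f (upTo N) (N ∷ [])) ⟩
  prodℕ (map f (upTo N) ++ f N ∷ [])    ≡⟨ prodℕ-++ (map f (upTo N)) (f N ∷ []) ⟩
  zUpTo N α ℕ.* (f N ℕ.* 1)             ≡⟨ cong (zUpTo N α ℕ.*_) (ℕ.*-identityʳ (f N)) ⟩
  zUpTo N α ℕ.* f N                     ∎
  where
  f : ℕ → ℕ
  f j = z-factor (suc j) (mult (suc j) α)

zUpTo-size+ : ∀ α k → zUpTo (size α ℕ.+ k) α ≡ z α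
zUpTo-size+ α zero    = cong (λ N → zUpTo N α) (ℕ.+-identityʳ (size α))
zUpTo-size+ α (suc k) = begin
  zUpTo (size α ℕ.+ suc k) α
    ≡⟨ cong (λ N → zUpTo N α) (ℕ.+-suc (size α) k) ⟩
  zUpTo (suc N) α
    ≡⟨ zUpTo-suc N α ⟩
  zUpTo N α ℕ.* z-factor (suc N) (mult (suc N) α)
    ≡⟨ cong (λ m → zUpTo N α ℕ.* z-factor (suc N) m) (size<⇒mult≡0 (suc N) α (ℕ.s≤s (ℕ.m≤m+n (size α) k))) ⟩
  zUpTo N α ℕ.* 1
    ≡⟨ trans (ℕ.*-identityʳ (zUpTo N α)) (zUpTo-size+ α k) ⟩
  z α ∎
  where N = size α ℕ.+ k

z-merge : ∀ α β γ → size γ ≡ size α ℕ.+ size β → (∀ i → mult i γ ≡ mult i α ℕ.+ mult i β) →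
  z γ ≡ z α ℕ.* z β ℕ.* Cαβ α β
z-merge α β γ size-γ mult-γ = begin
  z γ
    ≡⟨ cong (λ N → zUpTo N γ) size-γ ⟩
  zUpTo N γ
    ≡⟨ prodℕ-cong (upTo N) (λ j → trans (cong (z-factor (suc j)) (mult-γ (suc j)))
                                         (z-factor-+ (suc j) (mult (suc j) α) (mult (suc j) β))) ⟩
  prodℕ (map (λ j → fα j ℕ.* fβ j ℕ.* c j) (upTo N))
    ≡⟨ trans (prodℕ-* (λ j → fα j ℕ.* fβ j) c (upTo N)) (cong (ℕ._* Cαβ α β) (prodℕ-* fα fβ (upTo N))) ⟩
  zUpTo N α ℕ.* zUpTo N β ℕ.* Cαβ α β
    ≡⟨ cong₂ (λ u v → u ℕ.* v ℕ.* Cαβ α β) (zUpTo-size+ α (size β))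
             (trans (cong (λ M → zUpTo M β) (ℕ.+-comm (size α) (size β))) (zUpTo-size+ β (size α))) ⟩
  z α ℕ.* z β ℕ.* Cαβ α β ∎
  where
  N = size α ℕ.+ size β
  fα fβ c : ℕ → ℕ
  fα j = z-factor (suc j) (mult (suc j) α)
  fβ j = z-factor (suc j) (mult (suc j) β)
  c  j = (mult (suc j) α ℕ.+ mult (suc j) β) C (mult (suc j) α)

z-shuffle : ∀ α β → All (λ γ → z γ ≡ z α ℕ.* z β ℕ.* Cαβ α β) (shuffle α β)
z-shuffle α β = All.tabulate λ {γ} γ∈ →
  z-merge α β γ (All.lookup (size-shuffle α β) γ∈) (λ i → All.lookup (mult-shuffle i α β) γ∈)

theorem5p3 : (α β : List ℕ) → IsComposition α → IsComposition β →
    (xs : List ℚ) →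
    Ψ α xs * Ψ β xs ≡ inv (Cαβ α β) * sumℚ (map (λ γ → Ψ γ xs) (shuffle α β))
theorem5p3 α β cα cβ xs = begin
  Ψ α xs * Ψ β xs
    ≡⟨ *-interchange (fromℕ (z α)) (ψ α xs) (fromℕ (z β)) (ψ β xs) ⟩
  (fromℕ (z α) * fromℕ (z β)) * (ψ α xs * ψ β xs)
    ≡⟨ cong₂ _*_ (sym (fromℕ-* (z α) (z β))) (ψ-shuffle xs cα cβ) ⟩
  fromℕ (z α ℕ.* z β) * S
    ≡⟨ fromℕ*≡inv*fromℕ* (z α ℕ.* z β) c {{Cαβ-nonZero α β}} S ⟩
  inv c * (fromℕ (z α ℕ.* z β ℕ.* c) * S)
    ≡⟨ cong (inv c *_) (*-distribˡ-∑ (fromℕ (z α ℕ.* z β ℕ.* c)) (shuffle α β) (λ γ → ψ γ xs)) ⟩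
  inv c * ∑ (shuffle α β) (λ γ → fromℕ (z α ℕ.* z β ℕ.* c) * ψ γ xs)
    ≡⟨ cong (inv c *_) (∑-cong-All (All.map (λ {γ} z-γ → cong (λ n → fromℕ n * ψ γ xs) (sym z-γ))
                                            (z-shuffle α β))) ⟩
  inv c * ∑ (shuffle α β) (λ γ → Ψ γ xs) ∎
  where
  c = Cαβ α β
  S = ∑ (shuffle α β) (λ γ → ψ γ xs)
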